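{- For every integer $n\ge 3$, the number of permutations of $[n]$ that contain exactly one occurrence of the pattern $132$, this occurrence occupying three consecutive positions, is $(n-2)C_{n-2}=\binom{2n-4}{n-3}$, where $C_k=\frac{1}{k+1}\binom{2k}{k}$.
   Context: An occurrence of $132$ in a permutation $\pi_1\cdots\pi_n$ is a triple of positions $i<j<k$ with $\pi_i<\pi_k<\pi_j$; it occupies consecutive positions if $j=i+1$ and $k=i+2$. -}

module Defs where

open import Data.Nat using (ℕ; zero; suc; _+_; _<_; _*_; _/_)
open import Data.Nat.Combinatorics using (_C_)
open import Data.Fin using (Fin; toℕ) renaming (_<_ to _<ᶠ_)
open import Data.Vec using (Vec; []; _∷_; lookup)
open import Data.List using (List)
open import Data.List.Relation.Unary.Unique.Propositional using (Unique)
open import Data.List.Membership.Propositional using (_∈_)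
open import Data.Product using (_×_; _,_; Σ)
open import Relation.Binary.PropositionalEquality using (_≡_)

IsPerm : ∀ {n} → Vec (Fin n) n → Set
IsPerm {n} w = (i j : Fin n) → lookup w i ≡ lookup w j → i ≡ j

Occ132 : ∀ {n} → Vec (Fin n) n → Fin n → Fin n → Fin n → Set
Occ132 w i j k = (i <ᶠ j) × (j <ᶠ k) × (lookup w i <ᶠ lookup w k) × (lookup w k <ᶠ lookup w j)

Consecutive : ∀ {n} → Fin n → Fin n → Fin n → Set
Consecutive i j k = (toℕ j ≡ suc (toℕ i)) × (toℕ k ≡ suc (toℕ j))

OneConsec132 : ∀ {n} → Vec (Fin n) n → Set
OneConsec132 {n} w =
  Σ (Fin n) λ i → Σ (Fin n) λ j → Σ (Fin n) λ k →
    Occ132 w i j k × Consecutive i j k ×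
    ((i′ j′ k′ : Fin n) → Occ132 w i′ j′ k′ → (i′ ≡ i) × (j′ ≡ j) × (k′ ≡ k))

Enumerates : (n : ℕ) → List (Vec (Fin n) n) → Set
Enumerates n L = Unique L × ((w : Vec (Fin n) n) → (w ∈ L → IsPerm w × OneConsec132 w) × (IsPerm w × OneConsec132 w → w ∈ L))

catalan : ℕ → ℕ
catalan k = ((2 * k) C k) / suc k

{-# OPTIONS --safe #-}
module Submission where

-- Let m = n − 2.  If the only 132 of a permutation π sits at positions i, i + 1, i + 2 with
-- values a, b, c, then c = a + 1 (an entry a + 1 anywhere else would complete a second
-- occurrence), and deleting the entries a and c leaves a 132-avoiding permutation ρ of [m].
-- Conversely a is recovered from ρ and i as the smallest of ρ i and the entries below ρ i to
-- its left, so π ↦ (ρ , i) is a bijection onto Av_m(132) × [m].  The 132-avoiders arise by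
-- inserting the maximum into an active gap (every entry to its left exceeds every entry to its
-- right); a permutation with k active gaps has children with 2, …, k + 1 active gaps, and
-- counting this generating tree by the ballot numbers gives |Av_m(132)| = C_m, while
-- m C_m = binom(2m, m − 1).

open import Defs
open import Data.Bool using (true; false; if_then_else_)
open import Data.Empty using (⊥; ⊥-elim)
open import Data.Fin using (Fin; zero; suc; toℕ; fromℕ; fromℕ<; inject₁; punchIn; punchOut)
  renaming (_≤_ to _≤ᶠ_)
open import Data.Fin.Properties
  using (toℕ-injective; toℕ<n; toℕ-fromℕ; toℕ-fromℕ<; toℕ-inject₁; punchIn-injective; punchInᵢ≢i;
         punchIn-punchOut; punchOut-injective; pigeonhole; any?; all?)
  renaming (_≟_ to _≟ᶠ_; _≤?_ to _≤ᶠ?_; suc-injective to Fin-suc-injective)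
open import Data.Nat using (ℕ; zero; suc; _+_; _∸_; _*_; _≤_; _<_; z≤n; s≤s; s≤s⁻¹; _≤?_; _<?_; _/_)
open import Data.Nat.Combinatorics
  using (_C_; nCk≡nC[n∸k]; nCn≡1; nC1≡n; nCk+nC[k+1]≡[n+1]C[k+1]; k>n⇒nCk≡0)
open import Data.Nat.DivMod using (m*n/n≡m)
open import Data.Nat.ListAction using (sum)
open import Data.Nat.ListAction.Properties using (sum-++)
open import Data.Nat.Properties
open import Data.Nat.Tactic.RingSolver using (solve-∀)
open import Data.List using (List; []; _∷_; _++_; [_]; map; length; concatMap; allFin; filter)
open import Data.List.Extrema ≤-totalOrder using (argmin; f[argmin]≤f[⊤]; f[argmin]≤f[xs]; argmin-sel)
open import Data.List.Membership.Propositional using (_∈_; find; lose)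
open import Data.List.Membership.Propositional.Properties
  using (∈-map⁺; ∈-map⁻; ∈-concatMap⁺; ∈-concatMap⁻; ∈-allFin; ∈-filter⁺; ∈-filter⁻)
open import Data.List.Properties using (length-map; length-++; length-tabulate; map-++; map-∘; map-cong)
import Data.List.Relation.Unary.All as All
open import Data.List.Relation.Unary.AllPairs using ([]; _∷_)
open import Data.List.Relation.Unary.Any using (here; there)
open import Data.List.Relation.Unary.Unique.Propositional using (Unique)
import Data.List.Relation.Unary.Unique.Propositional.Properties as Unique
open import Data.Product using (Σ; ∃; _×_; _,_; proj₁; proj₂)
open import Data.Sum using (_⊎_; inj₁; inj₂)
open import Data.Vec using (Vec; []; _∷_; lookup; insertAt; tabulate)
import Data.Vec as Vec
open import Data.Vec.Properties
  using (insertAt-lookup; insertAt-punchIn; lookup-map; lookup∘tabulate; tabulate∘lookup; tabulate-cong)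
open import Function using (_∘_)
open import Function.Bundles using (_⇔_; mk⇔)
open import Level using (0ℓ)
open import Relation.Binary using (Tri; tri<; tri≈; tri>)
open import Relation.Binary.PropositionalEquality hiding ([_]; J)
open import Relation.Nullary using (¬_; Dec; yes; no; does)
open import Relation.Nullary.Decidable using (_×-dec_; _→-dec_; does-⇔)
open import Relation.Unary using (Pred; Decidable)

private variable n : ℕ

toℕ-punchIn-< : (i : Fin (suc n)) (j : Fin n) → toℕ j < toℕ i → toℕ (punchIn i j) ≡ toℕ j
toℕ-punchIn-< (suc i) zero    _         = refl
toℕ-punchIn-< (suc i) (suc j) (s≤s j<i) = cong suc (toℕ-punchIn-< i j j<i)

toℕ-punchIn-≥ : (i : Fin (suc n)) (j : Fin n) → toℕ i ≤ toℕ j → toℕ (punchIn i j) ≡ suc (toℕ j)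
toℕ-punchIn-≥ zero    j       _         = refl
toℕ-punchIn-≥ (suc i) (suc j) (s≤s i≤j) = cong suc (toℕ-punchIn-≥ i j i≤j)

toℕ-punchIn-≤-suc : (i : Fin (suc n)) (j : Fin n) → toℕ (punchIn i j) ≤ suc (toℕ j)
toℕ-punchIn-≤-suc i j with toℕ j <? toℕ i
... | yes j<i = ≤-trans (≤-reflexive (toℕ-punchIn-< i j j<i)) (n≤1+n _)
... | no  j≮i = ≤-reflexive (toℕ-punchIn-≥ i j (≮⇒≥ j≮i))

punchIn-mono-< : (i : Fin (suc n)) (j k : Fin n) → toℕ j < toℕ k → toℕ (punchIn i j) < toℕ (punchIn i k)
punchIn-mono-< zero    j       k       j<k       = s≤s j<k
punchIn-mono-< (suc i) zero    (suc k) _         = s≤s z≤n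
punchIn-mono-< (suc i) (suc j) (suc k) (s≤s j<k) = s≤s (punchIn-mono-< i j k j<k)

punchIn-cancel-< : (i : Fin (suc n)) (j k : Fin n) → toℕ (punchIn i j) < toℕ (punchIn i k) → toℕ j < toℕ k
punchIn-cancel-< zero    j       k       (s≤s j<k) = j<k
punchIn-cancel-< (suc i) zero    (suc k) _         = s≤s z≤n
punchIn-cancel-< (suc i) (suc j) zero    ()
punchIn-cancel-< (suc i) (suc j) (suc k) (s≤s j<k) = s≤s (punchIn-cancel-< i j k j<k)

punchIn<⇒< : (i : Fin (suc n)) (j : Fin n) → toℕ (punchIn i j) < toℕ i → toℕ j < toℕ i
punchIn<⇒< (suc i) zero    lt        = lt
punchIn<⇒< (suc i) (suc j) (s≤s lt) = s≤s (punchIn<⇒< i j lt)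

<punchIn⇒≤ : (i : Fin (suc n)) (j : Fin n) → toℕ i < toℕ (punchIn i j) → toℕ i ≤ toℕ j
<punchIn⇒≤ zero    j       _        = z≤n
<punchIn⇒≤ (suc i) (suc j) (s≤s lt) = s≤s (<punchIn⇒≤ i j lt)

<⇒punchIn< : (i : Fin (suc n)) (j : Fin n) → toℕ j < toℕ i → toℕ (punchIn i j) < toℕ i
<⇒punchIn< i j j<i = subst (_< toℕ i) (sym (toℕ-punchIn-< i j j<i)) j<i

≤⇒<punchIn : (i : Fin (suc n)) (j : Fin n) → toℕ i ≤ toℕ j → toℕ i < toℕ (punchIn i j)
≤⇒<punchIn i j i≤j = subst (toℕ i <_) (sym (toℕ-punchIn-≥ i j i≤j)) (s≤s i≤j)

toℕ-punchIn²-< : (c : Fin (suc (suc n))) (a : Fin (suc n)) (v : Fin n) →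
  toℕ v < toℕ a → toℕ a < toℕ c → toℕ (punchIn c (punchIn a v)) ≡ toℕ v
toℕ-punchIn²-< c a v v<a a<c = trans (toℕ-punchIn-< c (punchIn a v)
  (subst (_< toℕ c) (sym (toℕ-punchIn-< a v v<a)) (<-trans v<a a<c))) (toℕ-punchIn-< a v v<a)

toℕ-punchIn²-≥ : (c : Fin (suc (suc n))) (a : Fin (suc n)) (v : Fin n) →
  toℕ a ≤ toℕ v → toℕ c ≤ suc (toℕ v) → toℕ (punchIn c (punchIn a v)) ≡ suc (suc (toℕ v))
toℕ-punchIn²-≥ c a v a≤v c≤v+1 = trans (toℕ-punchIn-≥ c (punchIn a v)
  (subst (toℕ c ≤_) (sym (toℕ-punchIn-≥ a v a≤v)) c≤v+1)) (cong suc (toℕ-punchIn-≥ a v a≤v))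

data PunchInView (p : Fin (suc n)) : Fin (suc n) → Set where
  at     : PunchInView p p
  beside : (j : Fin n) → PunchInView p (punchIn p j)

punchInView : (p x : Fin (suc n)) → PunchInView p x
punchInView p x with p ≟ᶠ x
... | yes refl = at
... | no  p≢x  = subst (PunchInView p) (punchIn-punchOut p≢x) (beside (punchOut p≢x))

lookup-ext : ∀ {A : Set} (xs ys : Vec A n) → (∀ i → lookup xs i ≡ lookup ys i) → xs ≡ ys
lookup-ext xs ys eq = trans (sym (tabulate∘lookup xs)) (trans (tabulate-cong eq) (tabulate∘lookup ys))

insertEntry : Vec (Fin n) n → Fin (suc n) → Fin (suc n) → Vec (Fin (suc n)) (suc n)
insertEntry w p v = insertAt (Vec.map (punchIn v) w) p v

value : Vec (Fin n) n → Fin n → ℕ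
value w i = toℕ (lookup w i)

module _ (w : Vec (Fin n) n) (p v : Fin (suc n)) where

  lookup-insertEntry-at : lookup (insertEntry w p v) p ≡ v
  lookup-insertEntry-at = insertAt-lookup (Vec.map (punchIn v) w) p v

  lookup-insertEntry-punchIn : ∀ j → lookup (insertEntry w p v) (punchIn p j) ≡ punchIn v (lookup w j)
  lookup-insertEntry-punchIn j =
    trans (insertAt-punchIn (Vec.map (punchIn v) w) p v j) (lookup-map j (punchIn v) w)

  value-insertEntry-punchIn : ∀ j → value (insertEntry w p v) (punchIn p j) ≡ toℕ (punchIn v (lookup w j))
  value-insertEntry-punchIn j = cong toℕ (lookup-insertEntry-punchIn j)

  value-insertEntry-at : value (insertEntry w p v) p ≡ toℕ v
  value-insertEntry-at = cong toℕ lookup-insertEntry-at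

  insertEntry-below⁻ : ∀ j → value (insertEntry w p v) (punchIn p j) < toℕ v → value w j < toℕ v
  insertEntry-below⁻ j lt = punchIn<⇒< v (lookup w j) (subst (_< toℕ v) (value-insertEntry-punchIn j) lt)

  insertEntry-above⁻ : ∀ j → toℕ v < value (insertEntry w p v) (punchIn p j) → toℕ v ≤ value w j
  insertEntry-above⁻ j lt = <punchIn⇒≤ v (lookup w j) (subst (toℕ v <_) (value-insertEntry-punchIn j) lt)

  insertEntry-mono-< : ∀ j k → value w j < value w k →
    value (insertEntry w p v) (punchIn p j) < value (insertEntry w p v) (punchIn p k)
  insertEntry-mono-< j k lt = subst₂ _<_ (sym (value-insertEntry-punchIn j)) (sym (value-insertEntry-punchIn k))
    (punchIn-mono-< v _ _ lt)

  insertEntry-cancel-< : ∀ j k →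
    value (insertEntry w p v) (punchIn p j) < value (insertEntry w p v) (punchIn p k) → value w j < value w k
  insertEntry-cancel-< j k lt =
    punchIn-cancel-< v _ _ (subst₂ _<_ (value-insertEntry-punchIn j) (value-insertEntry-punchIn k) lt)

  Occ132-insertEntry⁺ : ∀ i j k → Occ132 w i j k →
    Occ132 (insertEntry w p v) (punchIn p i) (punchIn p j) (punchIn p k)
  Occ132-insertEntry⁺ i j k (i<j , j<k , wi<wk , wk<wj) =
    punchIn-mono-< p i j i<j , punchIn-mono-< p j k j<k ,
    insertEntry-mono-< i k wi<wk , insertEntry-mono-< k j wk<wj

  Occ132-insertEntry⁻ : ∀ i j k →
    Occ132 (insertEntry w p v) (punchIn p i) (punchIn p j) (punchIn p k) → Occ132 w i j k
  Occ132-insertEntry⁻ i j k (i<j , j<k , wi<wk , wk<wj) =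
    punchIn-cancel-< p i j i<j , punchIn-cancel-< p j k j<k ,
    insertEntry-cancel-< i k wi<wk , insertEntry-cancel-< k j wk<wj

  insertEntry-isPerm : IsPerm w → IsPerm (insertEntry w p v)
  insertEntry-isPerm w-perm x y = go (punchInView p x) (punchInView p y)
    where
    go : ∀ {x y} → PunchInView p x → PunchInView p y →
         lookup (insertEntry w p v) x ≡ lookup (insertEntry w p v) y → x ≡ y
    go at         at         _  = refl
    go at         (beside k) eq = ⊥-elim (punchInᵢ≢i v (lookup w k)
      (sym (trans (sym lookup-insertEntry-at) (trans eq (lookup-insertEntry-punchIn k)))))
    go (beside j) at         eq = ⊥-elim (punchInᵢ≢i v (lookup w j)
      (trans (sym (lookup-insertEntry-punchIn j)) (trans eq lookup-insertEntry-at)))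
    go (beside j) (beside k) eq = cong (punchIn p) (w-perm j k (punchIn-injective v _ _
      (trans (sym (lookup-insertEntry-punchIn j)) (trans eq (lookup-insertEntry-punchIn k)))))

insertEntry-injective : ∀ (w w′ : Vec (Fin n) n) p v → insertEntry w p v ≡ insertEntry w′ p v → w ≡ w′
insertEntry-injective w w′ p v eq = lookup-ext w w′ λ j → punchIn-injective v _ _
  (trans (sym (lookup-insertEntry-punchIn w p v j))
    (trans (cong (λ u → lookup u (punchIn p j)) eq) (lookup-insertEntry-punchIn w′ p v j)))

decompose : (π : Vec (Fin (suc n)) (suc n)) → IsPerm π → (p : Fin (suc n)) →
            Σ (Vec (Fin n) n) λ w → IsPerm w × π ≡ insertEntry w p (lookup π p)
decompose {n} π π-perm p = w , w-perm , lookup-ext π (insertEntry w p (lookup π p)) (λ x → go (punchInView p x))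
  where
  distinct : (j : Fin n) → lookup π p ≢ lookup π (punchIn p j)
  distinct j eq = punchInᵢ≢i p j (sym (π-perm _ _ eq))
  w : Vec (Fin n) n
  w = tabulate λ j → punchOut (distinct j)
  lookup-w : ∀ j → lookup w j ≡ punchOut (distinct j)
  lookup-w = lookup∘tabulate (λ j → punchOut (distinct j))
  w-perm : IsPerm w
  w-perm j k eq = punchIn-injective p j k (π-perm _ _
    (punchOut-injective (distinct j) (distinct k) (trans (sym (lookup-w j)) (trans eq (lookup-w k)))))
  go : ∀ {x} → PunchInView p x → lookup π x ≡ lookup (insertEntry w p (lookup π p)) x
  go at         = sym (lookup-insertEntry-at w p (lookup π p))
  go (beside j) = sym (begin
    lookup (insertEntry w p (lookup π p)) (punchIn p j) ≡⟨ lookup-insertEntry-punchIn w p (lookup π p) j ⟩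
    punchIn (lookup π p) (lookup w j)                    ≡⟨ cong (punchIn (lookup π p)) (lookup-w j) ⟩
    punchIn (lookup π p) (punchOut (distinct j))         ≡⟨ punchIn-punchOut (distinct j) ⟩
    lookup π (punchIn p j)                               ∎)
    where open ≡-Reasoning

isPerm-surjective : (π : Vec (Fin n) n) → IsPerm π → (v : Fin n) → ∃ λ p → lookup π p ≡ v
isPerm-surjective {suc n} π π-perm v with any? (λ p → lookup π p ≟ᶠ v)
... | yes hit = hit
... | no  miss with pigeonhole (n<1+n n) (λ p → punchOut {i = v} (λ eq → miss (p , sym eq)))
... | i , j , i<j , eq = ⊥-elim (<⇒≢ i<j (cong toℕ (π-perm i j
  (punchOut-injective (λ e → miss (i , sym e)) (λ e → miss (j , sym e)) eq))))

module _ {A B : Set} (f : A → List B) where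

  ∈-concatMap⁺′ : ∀ {xs x z} → x ∈ xs → z ∈ f x → z ∈ concatMap f xs
  ∈-concatMap⁺′ x∈ z∈ = ∈-concatMap⁺ f (lose x∈ z∈)

  ∈-concatMap⁻′ : ∀ xs {z} → z ∈ concatMap f xs → ∃ λ x → x ∈ xs × z ∈ f x
  ∈-concatMap⁻′ xs z∈ = find (∈-concatMap⁻ f z∈)

  concatMap-unique : ∀ {xs} → Unique xs → (∀ {x} → x ∈ xs → Unique (f x)) →
    (∀ {x y z} → x ∈ xs → y ∈ xs → z ∈ f x → z ∈ f y → x ≡ y) → Unique (concatMap f xs)
  concatMap-unique {[]}     _                  _        _          = []
  concatMap-unique {x ∷ xs} (x∉xs ∷ xs-unique) f-unique f-disjoint =
    Unique.++⁺ (f-unique (here refl))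
      (concatMap-unique xs-unique (f-unique ∘ there) λ x∈ y∈ → f-disjoint (there x∈) (there y∈))
      λ (z∈fx , z∈rest) → let y , y∈xs , z∈fy = ∈-concatMap⁻′ xs z∈rest in
        All.lookup x∉xs y∈xs (f-disjoint (here refl) (there y∈xs) z∈fx z∈fy)

  sum-concatMap : (g : B → ℕ) (xs : List A) →
    sum (map g (concatMap f xs)) ≡ sum (map (λ x → sum (map g (f x))) xs)
  sum-concatMap g []       = refl
  sum-concatMap g (x ∷ xs) = begin
    sum (map g (f x ++ concatMap f xs))                ≡⟨ cong sum (map-++ g (f x) (concatMap f xs)) ⟩
    sum (map g (f x) ++ map g (concatMap f xs))        ≡⟨ sum-++ (map g (f x)) _ ⟩
    sum (map g (f x)) + sum (map g (concatMap f xs))   ≡⟨ cong (sum (map g (f x)) +_) (sum-concatMap g xs) ⟩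
    sum (map g (f x)) + sum (map (λ x → sum (map g (f x))) xs) ∎
    where open ≡-Reasoning

  length-concatMap-const : (k : ℕ) → (∀ x → length (f x) ≡ k) →
                           ∀ xs → length (concatMap f xs) ≡ length xs * k
  length-concatMap-const k len-f []       = refl
  length-concatMap-const k len-f (x ∷ xs) =
    trans (length-++ (f x)) (cong₂ _+_ (len-f x) (length-concatMap-const k len-f xs))

-- The elements of Fin n satisfying P in increasing order, i.e. filter P? (allFin n) unfolded along n.
sites : {P : Pred (Fin n) 0ℓ} → Decidable P → List (Fin n)
sites {zero}  P? = []
sites {suc n} P? = if does (P? zero) then zero ∷ later else later
  where
  later : List (Fin (suc n))
  later = map suc (sites λ i → P? (suc i))

module _ {P : Pred (Fin (suc n)) 0ℓ} (P? : Decidable P) where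

  private
    later : List (Fin (suc n))
    later = map suc (sites λ i → P? (suc i))

  sites-accept : P zero → sites P? ≡ zero ∷ later
  sites-accept p0 with P? zero
  ... | yes _  = refl
  ... | no ¬p0 = ⊥-elim (¬p0 p0)

  sites-reject : ¬ P zero → sites P? ≡ later
  sites-reject ¬p0 with P? zero
  ... | yes p0 = ⊥-elim (¬p0 p0)
  ... | no _   = refl

∈-sites⁺ : {P : Pred (Fin n) 0ℓ} (P? : Decidable P) → ∀ {q} → P q → q ∈ sites P?
∈-sites⁺ {suc n} P? {zero} p0 rewrite sites-accept P? p0 = here refl
∈-sites⁺ {suc n} P? {suc q} pq with does (P? zero)
... | true  = there (∈-map⁺ suc (∈-sites⁺ (λ i → P? (suc i)) pq))
... | false = ∈-map⁺ suc (∈-sites⁺ (λ i → P? (suc i)) pq)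

∈-sites⁻ : {P : Pred (Fin n) 0ℓ} (P? : Decidable P) → ∀ {q} → q ∈ sites P? → P q
∈-later⁻ : {P : Pred (Fin (suc n)) 0ℓ} (P? : Decidable P) →
           ∀ {q} → q ∈ map suc (sites λ i → P? (suc i)) → P q

∈-sites⁻ {suc n} P? q∈ with P? zero
∈-sites⁻ {suc n} P? (here refl) | yes p0 = p0
∈-sites⁻ {suc n} P? (there q∈)  | yes _  = ∈-later⁻ P? q∈
∈-sites⁻ {suc n} P? q∈          | no _   = ∈-later⁻ P? q∈

∈-later⁻ P? q∈ with ∈-map⁻ suc q∈
... | r , r∈ , refl = ∈-sites⁻ (λ i → P? (suc i)) r∈

sites-unique : {P : Pred (Fin n) 0ℓ} (P? : Decidable P) → Unique (sites P?)
sites-unique {zero}  P? = []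
sites-unique {suc n} P? with does (P? zero)
... | true  = All.tabulate zero∉later ∷ later-unique
  where
  zero∉later : ∀ {x} → x ∈ map suc (sites λ i → P? (suc i)) → zero ≢ x
  zero∉later x∈ eq with ∈-map⁻ suc x∈
  zero∉later x∈ () | r , _ , refl
  later-unique : Unique (map suc (sites λ i → P? (suc i)))
  later-unique = Unique.map⁺ Fin-suc-injective (sites-unique λ i → P? (suc i))
... | false = Unique.map⁺ Fin-suc-injective (sites-unique λ i → P? (suc i))

sites-cong : {P Q : Pred (Fin n) 0ℓ} (P? : Decidable P) (Q? : Decidable Q) →
             (∀ i → P i ⇔ Q i) → sites P? ≡ sites Q?
sites-cong {zero}  _  _  _   = refl
sites-cong {suc n} P? Q? P⇔Q = cong₂ (λ b xs → if b then zero ∷ xs else xs)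
  (does-⇔ (P⇔Q zero) (P? zero) (Q? zero))
  (cong (map suc) (sites-cong (λ i → P? (suc i)) (λ i → Q? (suc i)) (λ i → P⇔Q (suc i))))

sitesFrom : {P : Pred (Fin n) 0ℓ} → Fin n → Decidable P → List (Fin n)
sitesFrom q P? = sites λ s → q ≤ᶠ? s ×-dec P? s

module _ {P : Pred (Fin (suc n)) 0ℓ} (P? : Decidable P) where

  sitesFrom-zero : sitesFrom zero P? ≡ sites P?
  sitesFrom-zero = sites-cong (λ s → zero {n} ≤ᶠ? s ×-dec P? s) P? λ _ → mk⇔ proj₂ (z≤n ,_)

  sitesFrom-suc : ∀ q → sitesFrom (suc q) P? ≡ map suc (sitesFrom q λ i → P? (suc i))
  sitesFrom-suc q = cong (map suc) (sites-cong (λ s → suc q ≤ᶠ? suc s ×-dec P? (suc s))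
                                               (λ s → q ≤ᶠ? s ×-dec P? (suc s)) λ _ →
    mk⇔ (λ (le , p) → s≤s⁻¹ le , p) (λ (le , p) → s≤s le , p))

sumTo : (ℕ → ℕ) → ℕ → ℕ
sumTo g zero    = 0
sumTo g (suc k) = sumTo g k + g (suc k)

-- The q-th site from the right sees exactly q sites at or after itself.
sum-sitesFrom : {P : Pred (Fin n) 0ℓ} (g : ℕ → ℕ) (P? : Decidable P) →
  sum (map (λ q → g (length (sitesFrom q P?))) (sites P?)) ≡ sumTo g (length (sites P?))
sum-sitesFrom-later : {P : Pred (Fin (suc n)) 0ℓ} (g : ℕ → ℕ) (P? : Decidable P) →
  let later = map suc (sites λ i → P? (suc i)) in
  sum (map (λ q → g (length (sitesFrom q P?))) later) ≡ sumTo g (length later)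

sum-sitesFrom {zero}  g P? = refl
sum-sitesFrom {suc n} {P} g P? = by-cases (P? zero)
  where
  open ≡-Reasoning
  G : Fin (suc n) → ℕ
  G q = g (length (sitesFrom q P?))
  later : List (Fin (suc n))
  later = map suc (sites λ i → P? (suc i))
  by-cases : Dec (P zero) → sum (map G (sites P?)) ≡ sumTo g (length (sites P?))
  by-cases (no ¬p0) = subst (λ xs → sum (map G xs) ≡ sumTo g (length xs)) (sym (sites-reject P? ¬p0))
    (sum-sitesFrom-later g P?)
  by-cases (yes p0) = begin
    sum (map G (sites P?))                          ≡⟨ cong (sum ∘ map G) (sites-accept P? p0) ⟩
    G zero + sum (map G later)                      ≡⟨ cong₂ _+_ first (sum-sitesFrom-later g P?) ⟩
    g (suc (length later)) + sumTo g (length later) ≡⟨ +-comm _ (sumTo g (length later)) ⟩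
    sumTo g (suc (length later))                    ≡⟨ cong (sumTo g ∘ length) (sym (sites-accept P? p0)) ⟩
    sumTo g (length (sites P?))                     ∎
    where
    first : G zero ≡ g (suc (length later))
    first = cong (g ∘ length) (trans (sitesFrom-zero P?) (sites-accept P? p0))

sum-sitesFrom-later {n} {P} g P? = begin
  sum (map (λ q → g (length (sitesFrom q P?))) (map suc S))     ≡⟨ cong sum (sym (map-∘ S)) ⟩
  sum (map (λ q → g (length (sitesFrom (suc q) P?))) S)         ≡⟨ cong sum (map-cong shift S) ⟩
  sum (map (λ q → g (length (sitesFrom q P?′))) S)              ≡⟨ sum-sitesFrom g P?′ ⟩
  sumTo g (length S)                                            ≡⟨ cong (sumTo g) (sym (length-map suc S)) ⟩
  sumTo g (length (map suc S))                                  ∎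
  where
  open ≡-Reasoning
  P?′ : Decidable λ i → P (suc i)
  P?′ = λ i → P? (suc i)
  S : List (Fin n)
  S = sites P?′
  shift : ∀ q → g (length (sitesFrom (suc q) P?)) ≡ g (length (sitesFrom q P?′))
  shift q = cong g (trans (cong length (sitesFrom-suc P? q)) (length-map suc (sitesFrom q P?′)))

-- The generating tree of 132-avoiders

Avoids132 : Vec (Fin n) n → Set
Avoids132 {n} w = (i j k : Fin n) → ¬ Occ132 w i j k

avoids132-insertEntry⁻ : ∀ (w : Vec (Fin n) n) p v → Avoids132 (insertEntry w p v) → Avoids132 w
avoids132-insertEntry⁻ w p v avoids i j k occ = avoids _ _ _ (Occ132-insertEntry⁺ w p v i j k occ)

-- The gap q lies between positions q - 1 and q.
Active : Vec (Fin n) n → Fin (suc n) → Set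
Active {n} w q = (x y : Fin n) → toℕ x < toℕ q → toℕ q ≤ toℕ y → value w y < value w x

Active? : (w : Vec (Fin n) n) → Decidable (Active w)
Active? w q = all? λ x → all? λ y →
  (toℕ x <? toℕ q) →-dec ((toℕ q ≤? toℕ y) →-dec (value w y <? value w x))

insertMax : Vec (Fin n) n → Fin (suc n) → Vec (Fin (suc n)) (suc n)
insertMax {n} w q = insertEntry w q (fromℕ n)

module _ (w : Vec (Fin n) n) (q : Fin (suc n)) where

  private
    π : Vec (Fin (suc n)) (suc n)
    π = insertMax w q

  value-insertMax-at : value π q ≡ n
  value-insertMax-at = trans (cong toℕ (lookup-insertEntry-at w q (fromℕ n))) (toℕ-fromℕ n)

  value-insertMax-punchIn : ∀ j → value π (punchIn q j) ≡ value w j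
  value-insertMax-punchIn j = trans (value-insertEntry-punchIn w q (fromℕ n) j)
    (toℕ-punchIn-< (fromℕ n) (lookup w j) (subst (value w j <_) (sym (toℕ-fromℕ n)) (toℕ<n (lookup w j))))

  value-insertMax-≤ : ∀ x → value π x ≤ n
  value-insertMax-≤ x = s≤s⁻¹ (toℕ<n (lookup π x))

  value-insertMax-< : ∀ j → value π (punchIn q j) < n
  value-insertMax-< j = subst (_< n) (sym (value-insertMax-punchIn j)) (toℕ<n (lookup w j))

  -- A new occurrence would have to use the maximum as its 3, i.e. straddle the gap q.
  insertMax-avoids132 : Avoids132 w → Active w q → Avoids132 π
  insertMax-avoids132 avoids active i j k = go (punchInView q i) (punchInView q j) (punchInView q k)
    where
    go : ∀ {i j k} → PunchInView q i → PunchInView q j → PunchInView q k → ¬ Occ132 π i j k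
    go {k = k} at _ _ (_ , _ , πq<πk , _) =
      <⇒≱ (subst (_< value π k) value-insertMax-at πq<πk) (value-insertMax-≤ k)
    go {j = j} (beside _) _ at (_ , _ , _ , πq<πj) =
      <⇒≱ (subst (_< value π j) value-insertMax-at πq<πj) (value-insertMax-≤ j)
    go (beside i) at (beside k) (i<q , q<k , πi<πk , _) =
      <-asym (subst₂ _<_ (value-insertMax-punchIn i) (value-insertMax-punchIn k) πi<πk)
             (active i k (punchIn<⇒< q i i<q) (<punchIn⇒≤ q k q<k))
    go (beside i) (beside j) (beside k) occ = avoids i j k (Occ132-insertEntry⁻ w q (fromℕ n) i j k occ)

  insertMax-avoids132⇒active : IsPerm w → Avoids132 π → Active w q
  insertMax-avoids132⇒active w-perm avoids x y x<q q≤y with <-cmp (value w y) (value w x)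
  ... | tri< wy<wx _ _ = wy<wx
  ... | tri≈ _ wy≡wx _ =
    ⊥-elim (<⇒≱ x<q (subst (λ z → toℕ q ≤ toℕ z) (w-perm y x (toℕ-injective wy≡wx)) q≤y))
  ... | tri> _ _ wx<wy = ⊥-elim (avoids (punchIn q x) q (punchIn q y)
    ( <⇒punchIn< q x x<q , ≤⇒<punchIn q y q≤y
    , subst₂ _<_ (sym (value-insertMax-punchIn x)) (sym (value-insertMax-punchIn y)) wx<wy
    , subst (value π (punchIn q y) <_) (sym value-insertMax-at) (value-insertMax-< y)))

  active-insertMax-zero : Active π zero
  active-insertMax-zero x y ()

  active-insertMax-suc⇒≤ : ∀ s → Active π (suc s) → toℕ q ≤ toℕ s
  active-insertMax-suc⇒≤ s active with toℕ q ≤? toℕ s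
  ... | yes q≤s = q≤s
  ... | no  q≰s = ⊥-elim (<⇒≱ (subst (_< value π zero) value-insertMax-at
          (active zero q (s≤s z≤n) (≰⇒> q≰s))) (value-insertMax-≤ zero))

  active-insertMax-suc⇒active : ∀ s → Active π (suc s) → toℕ q ≤ toℕ s → Active w s
  active-insertMax-suc⇒active s active q≤s x y x<s s≤y = insertEntry-cancel-< w q (fromℕ n) y x
    (active (punchIn q x) (punchIn q y) (s≤s (≤-trans (toℕ-punchIn-≤-suc q x) x<s))
      (subst (suc (toℕ s) ≤_) (sym (toℕ-punchIn-≥ q y (≤-trans q≤s s≤y))) (s≤s s≤y)))

  active⇒active-insertMax-suc : ∀ s → toℕ q ≤ toℕ s → Active w s → Active π (suc s)
  active⇒active-insertMax-suc s q≤s active x y x<s+1 s<y = right (punchInView q y) s<y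
    where
    right : ∀ {y} → PunchInView q y → toℕ s < toℕ y → value π y < value π x
    right at         s<q = ⊥-elim (<⇒≱ s<q q≤s)
    right (beside y) s<y = left (punchInView q x) x<s+1
      where
      s≤y : toℕ s ≤ toℕ y
      s≤y with toℕ y <? toℕ q
      ... | yes y<q = ⊥-elim (<⇒≱ (<⇒punchIn< q y y<q) (≤-trans q≤s (<⇒≤ s<y)))
      ... | no  y≮q = s≤s⁻¹ (subst (toℕ s <_) (toℕ-punchIn-≥ q y (≮⇒≥ y≮q)) s<y)
      left : ∀ {x} → PunchInView q x → toℕ x < suc (toℕ s) → value π (punchIn q y) < value π x
      left at         _     = subst (value π (punchIn q y) <_) (sym value-insertMax-at) (value-insertMax-< y)
      left (beside x) x<s+1 = insertEntry-mono-< w q (fromℕ n) y x (active x y x<s s≤y)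
        where
        x<s : toℕ x < toℕ s
        x<s with toℕ x <? toℕ q
        ... | yes x<q = <-≤-trans x<q q≤s
        ... | no  x≮q = s≤s⁻¹ (subst (_< suc (toℕ s)) (toℕ-punchIn-≥ q x (≮⇒≥ x≮q)) x<s+1)

  active-insertMax-suc : ∀ s → Active π (suc s) ⇔ (q ≤ᶠ s × Active w s)
  active-insertMax-suc s = mk⇔
    (λ active → let q≤s = active-insertMax-suc⇒≤ s active in q≤s , active-insertMax-suc⇒active s active q≤s)
    (λ (q≤s , active) → active⇒active-insertMax-suc s q≤s active)

label : Vec (Fin n) n → ℕ
label w = length (sites (Active? w))

label-insertMax : (w : Vec (Fin n) n) (q : Fin (suc n)) →
  label (insertMax w q) ≡ suc (length (sitesFrom q (Active? w)))
label-insertMax {n} w q = begin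
  length (sites (Active? π))
    ≡⟨ cong length (sites-accept (Active? π) (active-insertMax-zero w q)) ⟩
  suc (length (map suc (sites λ s → Active? π (suc s))))
    ≡⟨ cong suc (length-map suc (sites λ s → Active? π (suc s))) ⟩
  suc (length (sites λ s → Active? π (suc s)))
    ≡⟨ cong (suc ∘ length) (sites-cong (λ s → Active? π (suc s)) (λ s → q ≤ᶠ? s ×-dec Active? w s)
                                       (active-insertMax-suc w q)) ⟩
  suc (length (sitesFrom q (Active? w))) ∎
  where
  open ≡-Reasoning
  π : Vec (Fin (suc n)) (suc n)
  π = insertMax w q

insertMax-position-injective : ∀ (w w′ : Vec (Fin n) n) q q′ → insertMax w q ≡ insertMax w′ q′ → q ≡ q′
insertMax-position-injective {n} w w′ q q′ eq with punchInView q′ q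
... | at       = refl
... | beside j = ⊥-elim (punchInᵢ≢i (fromℕ n) (lookup w′ j) (begin
  punchIn (fromℕ n) (lookup w′ j)                     ≡⟨ sym (lookup-insertEntry-punchIn w′ q′ (fromℕ n) j) ⟩
  lookup (insertMax w′ q′) (punchIn q′ j)             ≡⟨ cong (λ u → lookup u (punchIn q′ j)) (sym eq) ⟩
  lookup (insertMax w (punchIn q′ j)) (punchIn q′ j)  ≡⟨ lookup-insertEntry-at w (punchIn q′ j) (fromℕ n) ⟩
  fromℕ n                                             ∎))
  where open ≡-Reasoning

children : Vec (Fin n) n → List (Vec (Fin (suc n)) (suc n))
children w = map (insertMax w) (sites (Active? w))

avoiders : (n : ℕ) → List (Vec (Fin n) n)
avoiders zero    = [ [] ]
avoiders (suc n) = concatMap children (avoiders n)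

avoiders-sound : ∀ n {w} → w ∈ avoiders n → IsPerm w × Avoids132 w
avoiders-sound zero    {[]} _  = (λ ()) , (λ ())
avoiders-sound (suc n) π∈ with ∈-concatMap⁻′ children (avoiders n) π∈
... | w , w∈ , π∈children with ∈-map⁻ (insertMax w) π∈children
... | q , q∈ , refl =
  let w-perm , w-avoids = avoiders-sound n w∈ in
  insertEntry-isPerm w q (fromℕ n) w-perm ,
  insertMax-avoids132 w q w-avoids (∈-sites⁻ (Active? w) q∈)

avoiders-complete : ∀ n (w : Vec (Fin n) n) → IsPerm w → Avoids132 w → w ∈ avoiders n
avoiders-complete zero    [] _ _ = here refl
avoiders-complete (suc n) π π-perm π-avoids with isPerm-surjective π π-perm (fromℕ n)
... | p , πp≡max with decompose π π-perm p
... | w , w-perm , π≡ = subst (_∈ avoiders (suc n)) (sym π≡max)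
  (∈-concatMap⁺′ children (avoiders-complete n w w-perm (avoids132-insertEntry⁻ w p (fromℕ n) avoids))
    (∈-map⁺ (insertMax w) (∈-sites⁺ (Active? w) (insertMax-avoids132⇒active w p w-perm avoids))))
  where
  π≡max : π ≡ insertMax w p
  π≡max = trans π≡ (cong (insertEntry w p) πp≡max)
  avoids : Avoids132 (insertMax w p)
  avoids = subst Avoids132 π≡max π-avoids

avoiders-unique : ∀ n → Unique (avoiders n)
avoiders-unique zero    = All.[] ∷ []
avoiders-unique (suc n) = concatMap-unique children (avoiders-unique n)
  (λ {w} _ → Unique.map⁺ (insertMax-position-injective w w _ _) (sites-unique (Active? w)))
  disjoint
  where
  disjoint : ∀ {w w′ π} → w ∈ avoiders n → w′ ∈ avoiders n →
             π ∈ children w → π ∈ children w′ → w ≡ w′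
  disjoint {w} {w′} _ _ π∈ π∈′ with ∈-map⁻ (insertMax w) π∈ | ∈-map⁻ (insertMax w′) π∈′
  ... | q , _ , π≡ | q′ , _ , π≡′ with insertMax-position-injective w w′ q q′ (trans (sym π≡) π≡′)
  ... | refl = insertEntry-injective w w′ q (fromℕ n) (trans (sym π≡) π≡′)

-- descendants r k counts the nodes at depth r below a node labelled k in the generating tree
-- in which a node labelled k has children labelled 2, 3, …, k + 1.
descendants : ℕ → ℕ → ℕ
descendants zero    k = 1
descendants (suc r) k = sumTo (λ i → descendants r (suc i)) k

children-descendants : ∀ r (w : Vec (Fin n) n) →
  sum (map (descendants r ∘ label) (children w)) ≡ descendants (suc r) (label w)
children-descendants r w = begin
  sum (map (descendants r ∘ label) (map (insertMax w) (sites (Active? w))))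
    ≡⟨ cong sum (sym (map-∘ (sites (Active? w)))) ⟩
  sum (map (λ q → descendants r (label (insertMax w q))) (sites (Active? w)))
    ≡⟨ cong sum (map-cong (λ q → cong (descendants r) (label-insertMax w q)) (sites (Active? w))) ⟩
  sum (map (λ q → descendants r (suc (length (sitesFrom q (Active? w))))) (sites (Active? w)))
    ≡⟨ sum-sitesFrom (descendants r ∘ suc) (Active? w) ⟩
  descendants (suc r) (label w) ∎
  where open ≡-Reasoning

descendants-avoiders : ∀ n r → sum (map (descendants r ∘ label) (avoiders n)) ≡ descendants (n + r) 1
descendants-avoiders zero    r =
  trans (+-identityʳ _) (cong (descendants r ∘ length) (sites-accept (Active? []) λ ()))
descendants-avoiders (suc n) r = begin
  sum (map (descendants r ∘ label) (concatMap children (avoiders n)))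
    ≡⟨ sum-concatMap children (descendants r ∘ label) (avoiders n) ⟩
  sum (map (λ w → sum (map (descendants r ∘ label) (children w))) (avoiders n))
    ≡⟨ cong sum (map-cong (children-descendants r) (avoiders n)) ⟩
  sum (map (descendants (suc r) ∘ label) (avoiders n))
    ≡⟨ descendants-avoiders n (suc r) ⟩
  descendants (n + suc r) 1
    ≡⟨ cong (λ d → descendants d 1) (+-suc n r) ⟩
  descendants (suc n + r) 1 ∎
  where open ≡-Reasoning

length-avoiders : ∀ n → length (avoiders n) ≡ descendants n 1
length-avoiders n = begin
  length (avoiders n)                               ≡⟨ length≡sum-ones (avoiders n) ⟩
  sum (map (descendants 0 ∘ label) (avoiders n))    ≡⟨ descendants-avoiders n 0 ⟩
  descendants (n + 0) 1                             ≡⟨ cong (λ d → descendants d 1) (+-identityʳ n) ⟩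
  descendants n 1                                   ∎
  where
  open ≡-Reasoning
  length≡sum-ones : ∀ (ws : List (Vec (Fin n) n)) → length ws ≡ sum (map (descendants 0 ∘ label) ws)
  length≡sum-ones []       = refl
  length≡sum-ones (_ ∷ ws) = cong suc (length≡sum-ones ws)

-- Ballot and Catalan numbers

nC0≡1 : ∀ n → n C 0 ≡ 1
nC0≡1 n = trans (nCk≡nC[n∸k] {n = n} z≤n) (nCn≡1 n)

pascal : ∀ n k → suc n C suc k ≡ n C k + n C suc k
pascal n k = sym (nCk+nC[k+1]≡[n+1]C[k+1] n k)

-- The top row 2r + 1 + k is written k + suc (r + r), so that it grows definitionally with k.
descendants-ballot : ∀ r k → descendants (suc r) k + (k + suc (r + r)) C r ≡ (k + suc (r + r)) C suc r
descendants-doubled : ∀ r k → let Y = k + suc (r + r) in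
  descendants r (suc (suc k)) + suc Y C r ≡ Y C r + Y C r

descendants-ballot r zero = begin
  suc (r + r) C r                ≡⟨ nCk≡nC[n∸k] (m≤n+m r (suc r)) ⟩
  (suc r + r) C (suc r + r ∸ r)  ≡⟨ cong ((suc r + r) C_) (m+n∸n≡m (suc r) r) ⟩
  suc (r + r) C suc r            ∎
  where open ≡-Reasoning
descendants-ballot r (suc k) = begin
  (D k + descendants r (suc (suc k))) + suc Y C r ≡⟨ +-assoc (D k) _ _ ⟩
  D k + (descendants r (suc (suc k)) + suc Y C r) ≡⟨ cong (D k +_) (descendants-doubled r k) ⟩
  D k + (Y C r + Y C r)                            ≡⟨ +-assoc (D k) _ _ ⟨
  (D k + Y C r) + Y C r                            ≡⟨ cong (_+ Y C r) (descendants-ballot r k) ⟩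
  Y C suc r + Y C r                                ≡⟨ +-comm (Y C suc r) (Y C r) ⟩
  Y C r + Y C suc r                                ≡⟨ pascal Y r ⟨
  suc Y C suc r                                    ∎
  where
  open ≡-Reasoning
  D : ℕ → ℕ
  D = descendants (suc r)
  Y : ℕ
  Y = k + suc (r + r)

descendants-doubled zero k =
  trans (cong suc (nC0≡1 (suc k + 1))) (sym (cong₂ _+_ (nC0≡1 (k + 1)) (nC0≡1 (k + 1))))
descendants-doubled (suc r) k = begin
  D + suc Y C suc r         ≡⟨ cong (D +_) (pascal Y r) ⟩
  D + (Y C r + Y C suc r)   ≡⟨ +-assoc D _ _ ⟨
  (D + Y C r) + Y C suc r   ≡⟨ cong (_+ Y C suc r) ballot ⟩
  Y C suc r + Y C suc r     ∎
  where
  open ≡-Reasoning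
  D : ℕ
  D = descendants (suc r) (suc (suc k))
  Y : ℕ
  Y = k + suc (suc r + suc r)
  rows : ∀ k r → suc (suc k) + suc (r + r) ≡ k + suc (suc r + suc r)
  rows = solve-∀
  ballot : D + Y C r ≡ Y C suc r
  ballot = subst (λ y → D + y C r ≡ y C suc r) (rows k r) (descendants-ballot r (suc (suc k)))

absorption : ∀ n k → suc k * (suc n C suc k) ≡ suc n * (n C k)
absorption zero    zero    = refl
absorption zero    (suc k) = trans (cong (suc (suc k) *_) (k>n⇒nCk≡0 {n = 1} {k = suc (suc k)} (s≤s (s≤s z≤n))))
  (trans (*-zeroʳ (suc (suc k))) (sym (cong (_+ 0) (k>n⇒nCk≡0 {n = 0} {k = suc k} (s≤s z≤n)))))
absorption (suc n) zero    = begin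
  suc (suc n) C 1 + 0      ≡⟨ +-identityʳ _ ⟩
  suc (suc n) C 1          ≡⟨ nC1≡n (suc (suc n)) ⟩
  suc (suc n)              ≡⟨ *-identityʳ (suc (suc n)) ⟨
  suc (suc n) * 1          ≡⟨ cong (suc (suc n) *_) (nC0≡1 (suc n)) ⟨
  suc (suc n) * (suc n C 0) ∎
  where open ≡-Reasoning
absorption (suc n) (suc k) = begin
  suc (suc k) * (suc (suc n) C suc (suc k))        ≡⟨ cong (suc (suc k) *_) (pascal (suc n) (suc k)) ⟩
  suc (suc k) * (a + b)                            ≡⟨ distribute k a b ⟩
  suc k * a + a + suc (suc k) * b
    ≡⟨ cong₂ (λ x y → x + a + y) (absorption n k) (absorption n (suc k)) ⟩
  suc n * (n C k) + a + suc n * (n C suc k)        ≡⟨ regroup (suc n) (n C k) a (n C suc k) ⟩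
  suc n * (n C k + n C suc k) + a                  ≡⟨ cong (λ x → suc n * x + a) (pascal n k) ⟨
  suc n * a + a                                    ≡⟨ +-comm (suc n * a) a ⟩
  suc (suc n) * a                                  ∎
  where
  open ≡-Reasoning
  a : ℕ
  a = suc n C suc k
  b : ℕ
  b = suc n C suc (suc k)
  distribute : ∀ k a b → suc (suc k) * (a + b) ≡ suc k * a + a + suc (suc k) * b
  distribute = solve-∀
  regroup : ∀ x y a z → x * y + a + x * z ≡ x * (y + z) + a
  regroup = solve-∀

central-binomial-shift : ∀ s → let B = suc (suc (s + s)) in suc s * (B C suc s) ≡ suc (suc s) * (B C s)
central-binomial-shift s = begin
  suc s * (B C suc s)                   ≡⟨ absorption A s ⟩
  B * (A C s)                           ≡⟨ cong (B *_) (nCk≡nC[n∸k] (m≤n+m s (suc s))) ⟩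
  B * (A C (suc s + s ∸ s))             ≡⟨ cong (λ k → B * (A C k)) (m+n∸n≡m (suc s) s) ⟩
  B * (A C suc s)                       ≡⟨ absorption A (suc s) ⟨
  suc (suc s) * (B C suc (suc s))       ≡⟨ cong (suc (suc s) *_) (nCk≡nC[n∸k] (s≤s (s≤s (m≤m+n s s)))) ⟩
  suc (suc s) * (B C (s + s ∸ s))       ≡⟨ cong (λ k → suc (suc s) * (B C k)) (m+n∸m≡n s s) ⟩
  suc (suc s) * (B C s)                 ∎
  where
  open ≡-Reasoning
  A : ℕ
  A = suc (s + s)
  B : ℕ
  B = suc A

twice-suc : ∀ s → 2 * suc s ≡ suc (suc (s + s))
twice-suc = solve-∀

suc-mul-descendants : ∀ s → suc s * descendants (suc s) 1 ≡ suc (suc (s + s)) C s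
suc-mul-descendants s = +-cancelʳ-≡ (m * (B C s)) (m * D) (B C s) (begin
  m * D + m * (B C s)  ≡⟨ *-distribˡ-+ m D (B C s) ⟨
  m * (D + B C s)      ≡⟨ cong (m *_) (descendants-ballot s 1) ⟩
  m * (B C m)          ≡⟨ central-binomial-shift s ⟩
  suc m * (B C s)      ∎)
  where
  open ≡-Reasoning
  m : ℕ
  m = suc s
  B : ℕ
  B = suc (suc (s + s))
  D : ℕ
  D = descendants m 1

catalan≡descendants : ∀ m → catalan m ≡ descendants m 1
catalan≡descendants zero    = refl
catalan≡descendants (suc s) = begin
  ((2 * m) C m) / suc m   ≡⟨ cong (λ t → (t C m) / suc m) (twice-suc s) ⟩
  (B C m) / suc m         ≡⟨ cong (_/ suc m) central ⟩
  (D * suc m) / suc m     ≡⟨ m*n/n≡m D (suc m) ⟩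
  D                       ∎
  where
  open ≡-Reasoning
  m : ℕ
  m = suc s
  B : ℕ
  B = suc (suc (s + s))
  D : ℕ
  D = descendants m 1
  central : B C m ≡ D * suc m
  central = begin
    B C m          ≡⟨ descendants-ballot s 1 ⟨
    D + B C s      ≡⟨ cong (D +_) (suc-mul-descendants s) ⟨
    D + m * D      ≡⟨ *-comm (suc m) D ⟩
    D * suc m      ∎

-- Expanding an avoider at a position

module _ (ρ : Vec (Fin n) n) (i : Fin n) where

  SmallerLeft : Pred (Fin n) 0ℓ
  SmallerLeft p = toℕ p < toℕ i × value ρ p < value ρ i

  SmallerLeft? : Decidable SmallerLeft
  SmallerLeft? p = (toℕ p <? toℕ i) ×-dec (value ρ p <? value ρ i)

  smallerLeft : List (Fin n)
  smallerLeft = filter SmallerLeft? (allFin n)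

  thresholdPosition : Fin n
  thresholdPosition = argmin (value ρ) i smallerLeft

  threshold : ℕ
  threshold = value ρ thresholdPosition

  threshold≤ : threshold ≤ value ρ i
  threshold≤ = f[argmin]≤f[⊤] {f = value ρ} i smallerLeft

  threshold-minimal : ∀ p → SmallerLeft p → threshold ≤ value ρ p
  threshold-minimal p smaller =
    All.lookup (f[argmin]≤f[xs] {f = value ρ} i smallerLeft) (∈-filter⁺ SmallerLeft? (∈-allFin p) smaller)

  thresholdPosition-sel : thresholdPosition ≡ i ⊎ SmallerLeft thresholdPosition
  thresholdPosition-sel with argmin-sel (value ρ) i smallerLeft
  ... | inj₁ at-i   = inj₁ at-i
  ... | inj₂ ∈left = inj₂ (proj₂ (∈-filter⁻ SmallerLeft? {xs = allFin n} ∈left))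

  threshold-characterization : ∀ a → a ≤ value ρ i → (∀ p → SmallerLeft p → a ≤ value ρ p) →
    a ≡ value ρ i ⊎ (∃ λ p → SmallerLeft p × value ρ p ≡ a) → threshold ≡ a
  threshold-characterization a a≤ρi a≤left attained = ≤-antisym (threshold≤a attained) a≤threshold
    where
    threshold≤a : a ≡ value ρ i ⊎ (∃ λ p → SmallerLeft p × value ρ p ≡ a) → threshold ≤ a
    threshold≤a (inj₁ a≡ρi)                 = subst (threshold ≤_) (sym a≡ρi) threshold≤
    threshold≤a (inj₂ (p , smaller , ρp≡a)) = subst (threshold ≤_) ρp≡a (threshold-minimal p smaller)
    a≤threshold : a ≤ threshold
    a≤threshold with thresholdPosition-sel
    ... | inj₁ at-i    = subst (λ p → a ≤ value ρ p) (sym at-i) a≤ρi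
    ... | inj₂ smaller = a≤left thresholdPosition smaller

  below-threshold⇒right : ∀ p → value ρ p < threshold → toℕ i < toℕ p
  below-threshold⇒right p ρp<t with <-cmp (toℕ p) (toℕ i)
  ... | tri< p<i _ _ = ⊥-elim (<⇒≱ ρp<t (threshold-minimal p (p<i , <-≤-trans ρp<t threshold≤)))
  ... | tri≈ _ p≡i _ =
    ⊥-elim (<⇒≱ ρp<t (subst (λ z → threshold ≤ value ρ z) (sym (toℕ-injective p≡i)) threshold≤))
  ... | tri> _ _ i<p = i<p

  -- Otherwise the threshold entry, ρ i and ρ q would form a 132.
  right-smaller⇒below-threshold : IsPerm ρ → Avoids132 ρ →
    ∀ q → toℕ i < toℕ q → value ρ q < value ρ i → value ρ q < threshold
  right-smaller⇒below-threshold ρ-perm ρ-avoids q i<q ρq<ρi with thresholdPosition-sel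
  ... | inj₁ at-i = subst (λ p → value ρ q < value ρ p) (sym at-i) ρq<ρi
  ... | inj₂ (p<i , ρp<ρi) with <-cmp (value ρ q) threshold
  ...   | tri< ρq<t _ _ = ρq<t
  ...   | tri≈ _ ρq≡t _ = ⊥-elim (<-asym p<i (subst (λ z → toℕ i < toℕ z)
                             (ρ-perm q thresholdPosition (toℕ-injective ρq≡t)) i<q))
  ...   | tri> _ _ t<ρq = ⊥-elim (ρ-avoids thresholdPosition i q (p<i , i<q , t<ρq , ρq<ρi))

thresholdEntry : Vec (Fin n) n → Fin n → Fin (suc n)
thresholdEntry ρ i = inject₁ (lookup ρ (thresholdPosition ρ i))

toℕ-thresholdEntry : ∀ (ρ : Vec (Fin n) n) i → toℕ (thresholdEntry ρ i) ≡ threshold ρ i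
toℕ-thresholdEntry ρ i = toℕ-inject₁ (lookup ρ (thresholdPosition ρ i))

-- Insert t just before position i and t + 1 just after the old entry ρ i, where t is the threshold.
expand : Vec (Fin n) n → Fin n → Vec (Fin (suc (suc n))) (suc (suc n))
expand ρ i = insertEntry (insertEntry ρ (inject₁ i) (thresholdEntry ρ i)) (suc (suc i)) (suc (thresholdEntry ρ i))

ConsecutiveAt : Fin n → Fin (suc (suc n)) → Fin (suc (suc n)) → Fin (suc (suc n)) → Set
ConsecutiveAt i x y z = toℕ x ≡ toℕ i × toℕ y ≡ suc (toℕ i) × toℕ z ≡ suc (suc (toℕ i))

module Expansion (ρ : Vec (Fin n) n) (i : Fin n) where

  t : Fin (suc n)
  t = thresholdEntry ρ i

  θ : ℕ
  θ = toℕ t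

  p₁ : Fin (suc n)
  p₁ = inject₁ i

  p₂ : Fin (suc (suc n))
  p₂ = suc (suc i)

  π₁ : Vec (Fin (suc n)) (suc n)
  π₁ = insertEntry ρ p₁ t

  π : Vec (Fin (suc (suc n))) (suc (suc n))
  π = insertEntry π₁ p₂ (suc t)

  value-π₁-p₁ : value π₁ p₁ ≡ θ
  value-π₁-p₁ = value-insertEntry-at ρ p₁ t

  θ≤ρi : θ ≤ value ρ i
  θ≤ρi = subst (_≤ value ρ i) (sym (toℕ-thresholdEntry ρ i)) (threshold≤ ρ i)

  below-θ⇒right : ∀ p → value ρ p < θ → toℕ i < toℕ p
  below-θ⇒right p lt = below-threshold⇒right ρ i p (subst (value ρ p <_) (toℕ-thresholdEntry ρ i) lt)

  p₁<p₂ : toℕ p₁ < toℕ p₂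
  p₁<p₂ = s≤s (≤-trans (≤-reflexive (toℕ-inject₁ i)) (n≤1+n _))

  toℕ-punchIn-p₂-p₁ : toℕ (punchIn p₂ p₁) ≡ toℕ i
  toℕ-punchIn-p₂-p₁ = trans (toℕ-punchIn-< p₂ p₁ p₁<p₂) (toℕ-inject₁ i)

  toℕ-punchIn-p₁-i : toℕ (punchIn p₁ i) ≡ suc (toℕ i)
  toℕ-punchIn-p₁-i = toℕ-punchIn-≥ p₁ i (≤-reflexive (toℕ-inject₁ i))

  toℕ-punchIn-p₂-punchIn-p₁-i : toℕ (punchIn p₂ (punchIn p₁ i)) ≡ suc (toℕ i)
  toℕ-punchIn-p₂-punchIn-p₁-i = trans
    (toℕ-punchIn-< p₂ (punchIn p₁ i) (subst (_< toℕ p₂) (sym toℕ-punchIn-p₁-i) (n<1+n _)))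
    toℕ-punchIn-p₁-i

  I J : Fin (suc (suc n))
  I = punchIn p₂ p₁
  J = punchIn p₂ (punchIn p₁ i)

  value-π-I : value π I ≡ θ
  value-π-I = begin
    value π I                            ≡⟨ value-insertEntry-punchIn π₁ p₂ (suc t) p₁ ⟩
    toℕ (punchIn (suc t) (lookup π₁ p₁)) ≡⟨ cong (toℕ ∘ punchIn (suc t)) (lookup-insertEntry-at ρ p₁ t) ⟩
    toℕ (punchIn (suc t) t)              ≡⟨ toℕ-punchIn-< (suc t) t (n<1+n _) ⟩
    θ                                    ∎
    where open ≡-Reasoning

  value-π-p₂ : value π p₂ ≡ suc θ
  value-π-p₂ = value-insertEntry-at π₁ p₂ (suc t)

  value-π-J : value π J ≡ suc (suc (value ρ i))
  value-π-J = begin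
    value π J
      ≡⟨ value-insertEntry-punchIn π₁ p₂ (suc t) (punchIn p₁ i) ⟩
    toℕ (punchIn (suc t) (lookup π₁ (punchIn p₁ i)))
      ≡⟨ cong (toℕ ∘ punchIn (suc t)) (lookup-insertEntry-punchIn ρ p₁ t i) ⟩
    toℕ (punchIn (suc t) (punchIn t (lookup ρ i)))
      ≡⟨ toℕ-punchIn-≥ (suc t) _ (subst (suc θ ≤_) (sym raised) (s≤s θ≤ρi)) ⟩
    suc (toℕ (punchIn t (lookup ρ i)))
      ≡⟨ cong suc raised ⟩
    suc (suc (value ρ i)) ∎
    where
    open ≡-Reasoning
    raised : toℕ (punchIn t (lookup ρ i)) ≡ suc (value ρ i)
    raised = toℕ-punchIn-≥ t (lookup ρ i) θ≤ρi

  π₁-below⁻ : ∀ j → value π₁ (punchIn p₁ j) < value π₁ p₁ → value ρ j < θ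
  π₁-below⁻ j lt = insertEntry-below⁻ ρ p₁ t j (subst (value π₁ (punchIn p₁ j) <_) value-π₁-p₁ lt)

  π₁-above⁻ : ∀ j → value π₁ p₁ < value π₁ (punchIn p₁ j) → θ ≤ value ρ j
  π₁-above⁻ j lt = insertEntry-above⁻ ρ p₁ t j (subst (_< value π₁ (punchIn p₁ j)) value-π₁-p₁ lt)

  π-below⁻ : ∀ x → value π (punchIn p₂ x) < value π p₂ → value π₁ x < suc θ
  π-below⁻ x lt = insertEntry-below⁻ π₁ p₂ (suc t) x (subst (value π (punchIn p₂ x) <_) value-π-p₂ lt)

  π-above⁻ : ∀ x → value π p₂ < value π (punchIn p₂ x) → suc θ ≤ value π₁ x
  π-above⁻ x lt = insertEntry-above⁻ π₁ p₂ (suc t) x (subst (_< value π (punchIn p₂ x)) value-π-p₂ lt)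

  occurrence : Occ132 π I J p₂
  occurrence =
    subst₂ _<_ (sym toℕ-punchIn-p₂-p₁) (sym toℕ-punchIn-p₂-punchIn-p₁-i) (n<1+n _) ,
    subst (_< toℕ p₂) (sym toℕ-punchIn-p₂-punchIn-p₁-i) (n<1+n _) ,
    subst₂ _<_ (sym value-π-I) (sym value-π-p₂) (n<1+n _) ,
    subst₂ _<_ (sym value-π-p₂) (sym value-π-J) (s≤s (s≤s θ≤ρi))

  module _ (ρ-perm : IsPerm ρ) (ρ-avoids : Avoids132 ρ) where

    -- If ρ z < ρ i then ρ z < θ; if ρ z > ρ i then ρ i, ρ y, ρ z form a 132.
    threshold-not-1 : ∀ y z → toℕ i ≤ toℕ y → toℕ y < toℕ z →
                      θ ≤ value ρ z → value ρ z < value ρ y → ⊥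
    threshold-not-1 y z i≤y y<z θ≤ρz ρz<ρy with <-cmp (value ρ z) (value ρ i)
    ... | tri< ρz<ρi _ _ = <⇒≱ (subst (value ρ z <_) (sym (toℕ-thresholdEntry ρ i))
            (right-smaller⇒below-threshold ρ i ρ-perm ρ-avoids z (≤-<-trans i≤y y<z) ρz<ρi)) θ≤ρz
    ... | tri≈ _ ρz≡ρi _ =
      <-irrefl (cong toℕ (sym (ρ-perm z i (toℕ-injective ρz≡ρi)))) (≤-<-trans i≤y y<z)
    ... | tri> _ _ ρi<ρz with m≤n⇒m<n∨m≡n i≤y
    ...   | inj₁ i<y = ρ-avoids i y z (i<y , y<z , ρi<ρz , ρz<ρy)
    ...   | inj₂ i≡y = <-asym ρi<ρz (subst (λ p → value ρ z < value ρ p) (sym (toℕ-injective i≡y)) ρz<ρy)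

    π₁-avoids132 : Avoids132 π₁
    π₁-avoids132 x y z = go (punchInView p₁ x) (punchInView p₁ y) (punchInView p₁ z)
      where
      left-of-i : ∀ j → toℕ (punchIn p₁ j) < toℕ p₁ → toℕ j < toℕ i
      left-of-i j lt = subst (toℕ j <_) (toℕ-inject₁ i) (punchIn<⇒< p₁ j lt)
      go : ∀ {x y z} → PunchInView p₁ x → PunchInView p₁ y → PunchInView p₁ z → ¬ Occ132 π₁ x y z
      go at at _ (x<y , _) = <-irrefl refl x<y
      go at (beside y) at (x<y , y<z , _) = <-asym x<y y<z
      go at (beside y) (beside z) (p₁<y , y<z , t<π₁z , π₁z<π₁y) = threshold-not-1 y z
        (subst (_≤ toℕ y) (toℕ-inject₁ i) (<punchIn⇒≤ p₁ y p₁<y)) (punchIn-cancel-< p₁ y z y<z)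
        (π₁-above⁻ z t<π₁z) (insertEntry-cancel-< ρ p₁ t z y π₁z<π₁y)
      go (beside x) at at (_ , y<z , _) = <-irrefl refl y<z
      go (beside x) at (beside z) (x<p₁ , _ , π₁x<π₁z , π₁z<t) = <-asym (left-of-i x x<p₁)
        (below-θ⇒right x (π₁-below⁻ x (<-trans π₁x<π₁z π₁z<t)))
      go (beside x) (beside y) at (x<y , y<p₁ , π₁x<t , _) = <-asym (left-of-i x (<-trans x<y y<p₁))
        (below-θ⇒right x (π₁-below⁻ x π₁x<t))
      go (beside x) (beside y) (beside z) occ = ρ-avoids x y z (Occ132-insertEntry⁻ ρ p₁ t x y z occ)

    π₁-below⇒beyond : ∀ x → value π₁ x < θ → suc (toℕ i) < toℕ x
    π₁-below⇒beyond x = go (punchInView p₁ x)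
      where
      go : ∀ {x} → PunchInView p₁ x → value π₁ x < θ → suc (toℕ i) < toℕ x
      go at         lt = ⊥-elim (<-irrefl value-π₁-p₁ lt)
      go (beside j) lt = subst (suc (toℕ i) <_)
        (sym (toℕ-punchIn-≥ p₁ j (subst (_≤ toℕ j) (sym (toℕ-inject₁ i)) (<⇒≤ i<j)))) (s≤s i<j)
        where
        i<j : toℕ i < toℕ j
        i<j = below-θ⇒right j (insertEntry-below⁻ ρ p₁ t j lt)

    π₁-below-suc : ∀ x → value π₁ x < suc θ → value π₁ x < θ ⊎ x ≡ p₁
    π₁-below-suc x lt with <-cmp (value π₁ x) θ
    ... | tri< π₁x<θ _ _ = inj₁ π₁x<θ
    ... | tri≈ _ π₁x≡θ _ = inj₂ (insertEntry-isPerm ρ p₁ t ρ-perm x p₁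
            (toℕ-injective (trans π₁x≡θ (sym value-π₁-p₁))))
    ... | tri> _ _ θ<π₁x = ⊥-elim (<⇒≱ lt θ<π₁x)

    -- An occurrence in π must use the new entries t and t + 1 as its 1 and its 2.
    occurrences-consecutive : ∀ x y z → Occ132 π x y z → ConsecutiveAt i x y z
    occurrences-consecutive x y z = go (punchInView p₂ x) (punchInView p₂ y) (punchInView p₂ z)
      where
      go : ∀ {x y z} → PunchInView p₂ x → PunchInView p₂ y → PunchInView p₂ z →
           Occ132 π x y z → ConsecutiveAt i x y z
      go at at _ (x<y , _) = ⊥-elim (<-irrefl refl x<y)
      go at (beside y) at (x<y , y<z , _) = ⊥-elim (<-asym x<y y<z)
      go at (beside y) (beside z) (p₂<y , y<z , t+1<πz , πz<πy) = ⊥-elim (π₁-avoids132 p₁ y z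
        ( <-≤-trans p₁<p₂ (<punchIn⇒≤ p₂ y p₂<y)
        , punchIn-cancel-< p₂ y z y<z
        , subst (_< value π₁ z) (sym value-π₁-p₁) (π-above⁻ z t+1<πz)
        , insertEntry-cancel-< π₁ p₂ (suc t) z y πz<πy ))
      go (beside x) at at (_ , y<z , _) = ⊥-elim (<-irrefl refl y<z)
      go (beside x) at (beside z) (x<p₂ , p₂<z , πx<πz , πz<t+1)
        with π₁-below-suc z (π-below⁻ z πz<t+1)
      ... | inj₁ π₁z<θ = ⊥-elim (<⇒≱ (punchIn<⇒< p₂ x x<p₂)
              (π₁-below⇒beyond x (<-trans (insertEntry-cancel-< π₁ p₂ (suc t) x z πx<πz) π₁z<θ)))
      ... | inj₂ refl  = ⊥-elim (<⇒≱ p₁<p₂ (<punchIn⇒≤ p₂ p₁ p₂<z))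
      go (beside x) (beside y) at (x<y , ↑y<p₂ , πx<t+1 , _)
        with π₁-below-suc x (π-below⁻ x πx<t+1)
      ... | inj₁ π₁x<θ =
        ⊥-elim (<⇒≱ (<-trans (punchIn-cancel-< p₂ x y x<y) y<p₂) (π₁-below⇒beyond x π₁x<θ))
        where
        y<p₂ : toℕ y < toℕ p₂
        y<p₂ = punchIn<⇒< p₂ y ↑y<p₂
      ... | inj₂ refl  = toℕ-punchIn-p₂-p₁ , y-next , refl
        where
        y<p₂ : toℕ y < toℕ p₂
        y<p₂ = punchIn<⇒< p₂ y ↑y<p₂
        y-next : toℕ (punchIn p₂ y) ≡ suc (toℕ i)
        y-next = trans (toℕ-punchIn-< p₂ y y<p₂)
          (≤-antisym (s≤s⁻¹ y<p₂) (subst (_< toℕ y) (toℕ-inject₁ i) (punchIn-cancel-< p₂ p₁ y x<y)))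
      go (beside x) (beside y) (beside z) occ =
        ⊥-elim (π₁-avoids132 x y z (Occ132-insertEntry⁻ π₁ p₂ (suc t) x y z occ))

    expand-oneConsec132 : OneConsec132 (expand ρ i)
    expand-oneConsec132 = I , J , p₂ , occurrence ,
      ( trans toℕ-punchIn-p₂-punchIn-p₁-i (cong suc (sym toℕ-punchIn-p₂-p₁))
      , cong suc (sym toℕ-punchIn-p₂-punchIn-p₁-i) ) ,
      λ x y z occ → let x≡ , y≡ , z≡ = occurrences-consecutive x y z occ in
        toℕ-injective (trans x≡ (sym toℕ-punchIn-p₂-p₁)) ,
        toℕ-injective (trans y≡ (sym toℕ-punchIn-p₂-punchIn-p₁-i)) ,
        toℕ-injective z≡

expand-isPerm : ∀ (ρ : Vec (Fin n) n) i → IsPerm ρ → IsPerm (expand ρ i)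
expand-isPerm ρ i ρ-perm = insertEntry-isPerm π₁ p₂ (suc t) (insertEntry-isPerm ρ p₁ t ρ-perm)
  where open Expansion ρ i

expand-position-injective : ∀ (ρ ρ′ : Vec (Fin n) n) i i′ → IsPerm ρ → Avoids132 ρ →
  expand ρ i ≡ expand ρ′ i′ → i ≡ i′
expand-position-injective ρ ρ′ i i′ ρ-perm ρ-avoids eq =
  toℕ-injective (trans (sym at-i) E′.toℕ-punchIn-p₂-p₁)
  where
  module E  = Expansion ρ i
  module E′ = Expansion ρ′ i′
  at-i : toℕ E′.I ≡ toℕ i
  at-i = proj₁ (E.occurrences-consecutive ρ-perm ρ-avoids E′.I E′.J E′.p₂
    (subst (λ u → Occ132 u E′.I E′.J E′.p₂) (sym eq) E′.occurrence))

expand-injective : ∀ (ρ ρ′ : Vec (Fin n) n) i → expand ρ i ≡ expand ρ′ i → ρ ≡ ρ′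
expand-injective ρ ρ′ i eq =
  insertEntry-injective ρ ρ′ E.p₁ E.t (insertEntry-injective E.π₁ _ E.p₂ (suc E.t) (trans eq (cong
    (λ s → insertEntry (insertEntry ρ′ E.p₁ s) E.p₂ (suc s)) (sym same-threshold))))
  where
  module E  = Expansion ρ i
  module E′ = Expansion ρ′ i
  same-threshold : E.t ≡ E′.t
  same-threshold = toℕ-injective (trans (sym E.value-π-I) (trans (cong (λ u → value u E.I) eq) E′.value-π-I))

-- Contracting the unique occurrence

module Contraction (π : Vec (Fin (suc (suc n))) (suc (suc n))) (π-perm : IsPerm π)
  (I J K : Fin (suc (suc n))) (occ : Occ132 π I J K)
  (J≡ : toℕ J ≡ suc (toℕ I)) (K≡ : toℕ K ≡ suc (toℕ J))
  (unique : ∀ x y z → Occ132 π x y z → x ≡ I × y ≡ J × z ≡ K) where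

  I<J : toℕ I < toℕ J
  I<J = proj₁ occ

  J<K : toℕ J < toℕ K
  J<K = proj₁ (proj₂ occ)

  πI<πK : value π I < value π K
  πI<πK = proj₁ (proj₂ (proj₂ occ))

  πK<πJ : value π K < value π J
  πK<πJ = proj₂ (proj₂ (proj₂ occ))

  not-first : ∀ {x} → toℕ x ≢ toℕ I → ∀ y z → ¬ Occ132 π x y z
  not-first x≢I y z occ′ = x≢I (cong toℕ (proj₁ (unique _ y z occ′)))

  not-last : ∀ {z} → toℕ z ≢ toℕ K → ∀ x y → ¬ Occ132 π x y z
  not-last z≢K x y occ′ = z≢K (cong toℕ (proj₂ (proj₂ (unique x y _ occ′))))

  -- An entry of value π I + 1 anywhere else would complete a second occurrence.
  value-K≡suc-value-I : value π K ≡ suc (value π I)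
  value-K≡suc-value-I with <-cmp (suc (value π I)) (value π K)
  ... | tri≈ _ eq _  = sym eq
  ... | tri> _ _ gt  = ⊥-elim (<⇒≱ πI<πK (s≤s⁻¹ gt))
  ... | tri< a+1<c _ _ with isPerm-surjective π π-perm (fromℕ< (<-trans a+1<c (toℕ<n (lookup π K))))
  ...   | p , πp≡ = ⊥-elim (by-position (<-cmp (toℕ p) (toℕ I)) (<-cmp (toℕ p) (toℕ K)))
    where
    πp : value π p ≡ suc (value π I)
    πp = trans (cong toℕ πp≡) (toℕ-fromℕ< (<-trans a+1<c (toℕ<n (lookup π K))))
    by-position : Tri (toℕ p < toℕ I) (toℕ p ≡ toℕ I) (toℕ I < toℕ p) →
                  Tri (toℕ p < toℕ K) (toℕ p ≡ toℕ K) (toℕ K < toℕ p) → ⊥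
    by-position (tri< p<I _ _) _ = not-first (<⇒≢ p<I) J K
      (<-trans p<I I<J , J<K , subst (_< value π K) (sym πp) a+1<c , πK<πJ)
    by-position (tri≈ _ p≡I _) _ = 1+n≢n (sym (trans (cong (value π) (sym (toℕ-injective p≡I))) πp))
    by-position (tri> _ _ I<p) (tri< p<K _ _) = <-asym (subst (_< value π K) (sym πp) a+1<c)
      (subst (value π K <_) (sym (cong (value π) p≡J)) πK<πJ)
      where
      p≡J : p ≡ J
      p≡J = toℕ-injective
        (≤-antisym (s≤s⁻¹ (subst (toℕ p <_) K≡ p<K)) (subst (_≤ toℕ p) (sym J≡) I<p))
    by-position (tri> _ _ _) (tri≈ _ p≡K _) =
      <-irrefl (trans (sym πp) (cong (value π) (toℕ-injective p≡K))) a+1<c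
    by-position (tri> _ _ _) (tri> _ _ K<p) = not-last (λ p≡K → <-irrefl (sym p≡K) K<p) I J
      (I<J , <-trans J<K K<p , subst (value π I <_) (sym πp) (n<1+n _) ,
       subst (_< value π J) (sym πp) (<-trans a+1<c πK<πJ))

  K≡I+2 : toℕ K ≡ suc (suc (toℕ I))
  K≡I+2 = trans K≡ (cong suc J≡)

  I<n : toℕ I < n
  I<n = s≤s⁻¹ (s≤s⁻¹ (subst (_< suc (suc n)) K≡I+2 (toℕ<n K)))

  i : Fin n
  i = fromℕ< I<n

  toℕ-i : toℕ i ≡ toℕ I
  toℕ-i = toℕ-fromℕ< I<n

  K≡i+2 : toℕ K ≡ suc (suc (toℕ i))
  K≡i+2 = trans K≡I+2 (cong (2 +_) (sym toℕ-i))

  K≡suc-suc-i : K ≡ suc (suc i)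
  K≡suc-suc-i = toℕ-injective K≡i+2

  module _ (π₁ : Vec (Fin (suc n)) (suc n)) (π≡ : π ≡ insertEntry π₁ K (lookup π K))
           (ρ : Vec (Fin n) n) (ρ-perm : IsPerm ρ)
           (π₁≡ : π₁ ≡ insertEntry ρ (inject₁ i) (lookup π₁ (inject₁ i))) where

    p₁ : Fin (suc n)
    p₁ = inject₁ i

    a′ : Fin (suc n)
    a′ = lookup π₁ p₁

    c′ : Fin (suc (suc n))
    c′ = lookup π K

    embed : Fin n → Fin (suc (suc n))
    embed j = punchIn K (punchIn p₁ j)

    toℕ-p₁ : toℕ p₁ ≡ toℕ I
    toℕ-p₁ = trans (toℕ-inject₁ i) toℕ-i

    p₁<K : toℕ p₁ < toℕ K
    p₁<K = subst₂ _<_ (sym toℕ-p₁) (sym K≡I+2) (≤-trans (n<1+n _) (n≤1+n _))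

    lookup-punchIn-K : ∀ x → lookup π (punchIn K x) ≡ punchIn c′ (lookup π₁ x)
    lookup-punchIn-K x =
      trans (cong (λ u → lookup u (punchIn K x)) π≡) (lookup-insertEntry-punchIn π₁ K c′ x)

    lookup-π₁-punchIn-p₁ : ∀ j → lookup π₁ (punchIn p₁ j) ≡ punchIn a′ (lookup ρ j)
    lookup-π₁-punchIn-p₁ j =
      trans (cong (λ u → lookup u (punchIn p₁ j)) π₁≡) (lookup-insertEntry-punchIn ρ p₁ a′ j)

    lookup-embed : ∀ j → lookup π (embed j) ≡ punchIn c′ (punchIn a′ (lookup ρ j))
    lookup-embed j = trans (lookup-punchIn-K (punchIn p₁ j)) (cong (punchIn c′) (lookup-π₁-punchIn-p₁ j))

    I≡ : I ≡ punchIn K p₁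
    I≡ = toℕ-injective (sym (trans (toℕ-punchIn-< K p₁ p₁<K) toℕ-p₁))

    lookup-I : lookup π I ≡ punchIn c′ a′
    lookup-I = trans (cong (lookup π) I≡) (lookup-punchIn-K p₁)

    a′<c′ : toℕ a′ < toℕ c′
    a′<c′ = punchIn<⇒< c′ a′ (subst (_< toℕ c′) (cong toℕ lookup-I) πI<πK)

    value-I≡a′ : value π I ≡ toℕ a′
    value-I≡a′ = trans (cong toℕ lookup-I) (toℕ-punchIn-< c′ a′ a′<c′)

    c′≡suc-a′ : toℕ c′ ≡ suc (toℕ a′)
    c′≡suc-a′ = trans value-K≡suc-value-I (cong suc value-I≡a′)

    toℕ-embed-< : ∀ j → toℕ j < toℕ i → toℕ (embed j) ≡ toℕ j
    toℕ-embed-< j j<i = toℕ-punchIn²-< K p₁ j (subst (toℕ j <_) (sym (toℕ-inject₁ i)) j<i) p₁<K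

    toℕ-embed-> : ∀ j → toℕ i < toℕ j → toℕ (embed j) ≡ suc (suc (toℕ j))
    toℕ-embed-> j i<j = toℕ-punchIn²-≥ K p₁ j (subst (_≤ toℕ j) (sym (toℕ-inject₁ i)) (<⇒≤ i<j))
      (subst (_≤ suc (toℕ j)) (sym K≡i+2) (s≤s i<j))

    J≡embed-i : J ≡ embed i
    J≡embed-i = toℕ-injective (trans J≡ (sym (trans (toℕ-punchIn-< K (punchIn p₁ i) p₁i<K) p₁i≡)))
      where
      p₁i≡ : toℕ (punchIn p₁ i) ≡ suc (toℕ I)
      p₁i≡ = trans (toℕ-punchIn-≥ p₁ i (≤-reflexive (toℕ-inject₁ i))) (cong suc toℕ-i)
      p₁i<K : toℕ (punchIn p₁ i) < toℕ K
      p₁i<K = subst₂ _<_ (sym p₁i≡) (sym K≡I+2) (n<1+n _)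

    J≡i+1 : toℕ J ≡ suc (toℕ i)
    J≡i+1 = trans J≡ (cong suc (sym toℕ-i))

    value-embed-< : ∀ j → value ρ j < toℕ a′ → value π (embed j) ≡ value ρ j
    value-embed-< j lt = trans (cong toℕ (lookup-embed j)) (toℕ-punchIn²-< c′ a′ (lookup ρ j) lt a′<c′)

    value-embed-≥ : ∀ j → toℕ a′ ≤ value ρ j → value π (embed j) ≡ suc (suc (value ρ j))
    value-embed-≥ j le = trans (cong toℕ (lookup-embed j))
      (toℕ-punchIn²-≥ c′ a′ (lookup ρ j) le (subst (_≤ suc (value ρ j)) (sym c′≡suc-a′) (s≤s le)))

    embed-occurrence : ∀ x y z → Occ132 ρ x y z → Occ132 π (embed x) (embed y) (embed z)
    embed-occurrence x y z occ′ = subst (λ u → Occ132 u (embed x) (embed y) (embed z)) (sym π≡)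
      (Occ132-insertEntry⁺ π₁ K c′ (punchIn p₁ x) (punchIn p₁ y) (punchIn p₁ z)
        (subst (λ u → Occ132 u (punchIn p₁ x) (punchIn p₁ y) (punchIn p₁ z)) (sym π₁≡)
          (Occ132-insertEntry⁺ ρ p₁ a′ x y z occ′)))

    ρ-avoids132 : Avoids132 ρ
    ρ-avoids132 x y z occ′ = punchInᵢ≢i p₁ x
      (punchIn-injective K _ _ (trans (proj₁ (unique _ _ _ (embed-occurrence x y z occ′))) I≡))

    a′≤ρi : toℕ a′ ≤ value ρ i
    a′≤ρi = ≮⇒≥ λ ρi<a′ → <-asym πK<πJ (subst₂ _<_
      (sym (trans (cong (value π) J≡embed-i) (value-embed-< i ρi<a′))) (sym c′≡suc-a′)
      (<-trans ρi<a′ (n<1+n _)))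

    a′≤smallerLeft : ∀ p → SmallerLeft ρ i p → toℕ a′ ≤ value ρ p
    a′≤smallerLeft p (p<i , _) = ≮⇒≥ λ ρp<a′ → not-first p≢I J K
      ( subst₂ _<_ (sym (toℕ-embed-< p p<i)) (sym J≡i+1) (<-trans p<i (n<1+n _))
      , J<K
      , subst₂ _<_ (sym (value-embed-< p ρp<a′)) (sym c′≡suc-a′) (<-trans ρp<a′ (n<1+n _))
      , πK<πJ )
      where
      p≢I : toℕ (embed p) ≢ toℕ I
      p≢I eq = <-irrefl (trans (sym (toℕ-embed-< p p<i)) (trans eq (sym toℕ-i))) p<i

    -- Together with the 1 and the 3 such an entry would form a second occurrence.
    a′-not-right : ∀ p → value ρ p ≡ toℕ a′ → toℕ a′ < value ρ i → ¬ (toℕ i < toℕ p)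
    a′-not-right p ρp≡a′ a′<ρi i<p = not-last p≢K I J (I<J , J<embed-p , πI<πp , πp<πJ)
      where
      πp : value π (embed p) ≡ suc (suc (toℕ a′))
      πp = trans (value-embed-≥ p (≤-reflexive (sym ρp≡a′))) (cong (2 +_) ρp≡a′)
      πJ : value π J ≡ suc (suc (value ρ i))
      πJ = trans (cong (value π) J≡embed-i) (value-embed-≥ i a′≤ρi)
      J<embed-p : toℕ J < toℕ (embed p)
      J<embed-p = subst₂ _<_ (sym J≡i+1) (sym (toℕ-embed-> p i<p)) (s≤s (≤-trans i<p (n≤1+n _)))
      πI<πp : value π I < value π (embed p)
      πI<πp = subst₂ _<_ (sym value-I≡a′) (sym πp) (≤-trans (n<1+n _) (n≤1+n _))
      πp<πJ : value π (embed p) < value π J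
      πp<πJ = subst₂ _<_ (sym πp) (sym πJ) (s≤s (s≤s a′<ρi))
      p≢K : toℕ (embed p) ≢ toℕ K
      p≢K eq = <-irrefl (sym (suc-injective (suc-injective (begin
        suc (suc (toℕ p)) ≡⟨ toℕ-embed-> p i<p ⟨
        toℕ (embed p)     ≡⟨ eq ⟩
        toℕ K             ≡⟨ K≡i+2 ⟩
        suc (suc (toℕ i)) ∎)))) i<p
        where open ≡-Reasoning

    a′-attained : toℕ a′ ≡ value ρ i ⊎ ∃ λ p → SmallerLeft ρ i p × value ρ p ≡ toℕ a′
    a′-attained with m≤n⇒m<n∨m≡n a′≤ρi
    ... | inj₂ a′≡ρi = inj₁ a′≡ρi
    ... | inj₁ a′<ρi with isPerm-surjective ρ ρ-perm (fromℕ< (<-trans a′<ρi (toℕ<n (lookup ρ i))))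
    ...   | p , ρp≡ = inj₂ (p , (p<i (<-cmp (toℕ p) (toℕ i)) , subst (_< value ρ i) (sym ρp) a′<ρi) , ρp)
      where
      ρp : value ρ p ≡ toℕ a′
      ρp = trans (cong toℕ ρp≡) (toℕ-fromℕ< (<-trans a′<ρi (toℕ<n (lookup ρ i))))
      p<i : Tri (toℕ p < toℕ i) (toℕ p ≡ toℕ i) (toℕ i < toℕ p) → toℕ p < toℕ i
      p<i (tri< p<i _ _) = p<i
      p<i (tri≈ _ p≡i _) = ⊥-elim (<-irrefl (trans (sym ρp) (cong (value ρ) (toℕ-injective p≡i))) a′<ρi)
      p<i (tri> _ _ i<p) = ⊥-elim (a′-not-right p ρp a′<ρi i<p)

    a′≡t : a′ ≡ thresholdEntry ρ i
    a′≡t = toℕ-injective (trans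
      (sym (threshold-characterization ρ i (toℕ a′) a′≤ρi a′≤smallerLeft a′-attained))
      (sym (toℕ-thresholdEntry ρ i)))

    π≡expand : π ≡ expand ρ i
    π≡expand = begin
      π                                               ≡⟨ π≡ ⟩
      insertEntry π₁ K c′                             ≡⟨ cong (λ u → insertEntry u K c′) π₁≡ ⟩
      insertEntry (insertEntry ρ p₁ a′) K c′
        ≡⟨ cong₂ (λ a c → insertEntry (insertEntry ρ p₁ a) K c) a′≡t c′≡suc-t ⟩
      insertEntry (insertEntry ρ p₁ t) K (suc t)
        ≡⟨ cong (λ k → insertEntry (insertEntry ρ p₁ t) k (suc t)) K≡suc-suc-i ⟩
      expand ρ i                                      ∎
      where
      open ≡-Reasoning
      t : Fin (suc n)
      t = thresholdEntry ρ i
      c′≡suc-t : c′ ≡ suc t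
      c′≡suc-t = toℕ-injective (trans c′≡suc-a′ (cong (suc ∘ toℕ) a′≡t))

oneConsec132⇒expand : (π : Vec (Fin (suc (suc n))) (suc (suc n))) → IsPerm π → OneConsec132 π →
  ∃ λ ρ → ∃ λ i → IsPerm ρ × Avoids132 ρ × π ≡ expand ρ i
oneConsec132⇒expand π π-perm (I , J , K , occ , (J≡ , K≡) , unique) =
  let π₁ , π₁-perm , π≡ = decompose π π-perm K
      ρ  , ρ-perm  , π₁≡ = decompose π₁ π₁-perm (inject₁ C.i)
  in ρ , C.i , ρ-perm , C.ρ-avoids132 π₁ π≡ ρ ρ-perm π₁≡ , C.π≡expand π₁ π≡ ρ ρ-perm π₁≡
  where module C = Contraction π π-perm I J K occ J≡ K≡ unique

expansionsOf : Vec (Fin n) n → List (Vec (Fin (suc (suc n))) (suc (suc n)))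
expansionsOf {n} ρ = map (expand ρ) (allFin n)

expansions : (n : ℕ) → List (Vec (Fin (suc (suc n))) (suc (suc n)))
expansions n = concatMap expansionsOf (avoiders n)

expansions-sound : ∀ n {π} → π ∈ expansions n → IsPerm π × OneConsec132 π
expansions-sound n π∈ with ∈-concatMap⁻′ expansionsOf (avoiders n) π∈
... | ρ , ρ∈ , π∈′ with ∈-map⁻ (expand ρ) π∈′
... | i , _ , refl = let ρ-perm , ρ-avoids = avoiders-sound n ρ∈ in
  expand-isPerm ρ i ρ-perm , Expansion.expand-oneConsec132 ρ i ρ-perm ρ-avoids

expansions-complete : ∀ n π → IsPerm π → OneConsec132 π → π ∈ expansions n
expansions-complete n π π-perm π-one =
  let ρ , i , ρ-perm , ρ-avoids , π≡ = oneConsec132⇒expand π π-perm π-one in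
  subst (_∈ expansions n) (sym π≡)
    (∈-concatMap⁺′ expansionsOf (avoiders-complete n ρ ρ-perm ρ-avoids)
      (∈-map⁺ (expand ρ) (∈-allFin i)))

expansions-unique : ∀ n → Unique (expansions n)
expansions-unique n = concatMap-unique expansionsOf (avoiders-unique n) expansionsOf-unique disjoint
  where
  expansionsOf-unique : ∀ {ρ} → ρ ∈ avoiders n → Unique (expansionsOf ρ)
  expansionsOf-unique {ρ} ρ∈ = let ρ-perm , ρ-avoids = avoiders-sound n ρ∈ in
    Unique.map⁺ (λ {i} {i′} → expand-position-injective ρ ρ i i′ ρ-perm ρ-avoids) (Unique.allFin⁺ n)
  disjoint : ∀ {ρ ρ′ π} → ρ ∈ avoiders n → ρ′ ∈ avoiders n →
             π ∈ expansionsOf ρ → π ∈ expansionsOf ρ′ → ρ ≡ ρ′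
  disjoint {ρ} {ρ′} ρ∈ _ π∈ π∈′ =
    let i  , _ , π≡  = ∈-map⁻ (expand ρ) π∈
        i′ , _ , π≡′ = ∈-map⁻ (expand ρ′) π∈′
        ρ-perm , ρ-avoids = avoiders-sound n ρ∈
        same : expand ρ i ≡ expand ρ′ i′
        same = trans (sym π≡) π≡′
    in expand-injective ρ ρ′ i (subst (λ k → expand ρ i ≡ expand ρ′ k)
         (sym (expand-position-injective ρ ρ′ i i′ ρ-perm ρ-avoids same)) same)

expansions-enumerate : ∀ n → Enumerates (suc (suc n)) (expansions n)
expansions-enumerate n = expansions-unique n ,
  λ π → expansions-sound n , λ (π-perm , π-one) → expansions-complete n π π-perm π-one

length-expansions : ∀ n → length (expansions n) ≡ n * descendants n 1
length-expansions n = begin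
  length (expansions n)    ≡⟨ length-concatMap-const expansionsOf n length-expansionsOf (avoiders n) ⟩
  length (avoiders n) * n  ≡⟨ cong (_* n) (length-avoiders n) ⟩
  descendants n 1 * n      ≡⟨ *-comm (descendants n 1) n ⟩
  n * descendants n 1      ∎
  where
  open ≡-Reasoning
  length-expansionsOf : ∀ ρ → length (expansionsOf ρ) ≡ n
  length-expansionsOf ρ = trans (length-map (expand ρ) (allFin n)) (length-tabulate (λ i → i))

twice-minus-four : ∀ s → 2 * (3 + s) ∸ 4 ≡ suc (suc (s + s))
twice-minus-four s = cong (_∸ 4) (twice-three-plus s)
  where
  twice-three-plus : ∀ s → 2 * (3 + s) ≡ 4 + suc (suc (s + s))
  twice-three-plus = solve-∀

lemma17 : (n : ℕ) → 3 ≤ n →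
    Σ (List (Vec (Fin n) n)) λ L → Enumerates n L ×
      (length L ≡ (n ∸ 2) * catalan (n ∸ 2)) × (length L ≡ (2 * n ∸ 4) C (n ∸ 3))
lemma17 (suc (suc (suc s))) (s≤s (s≤s (s≤s z≤n))) =
  expansions (suc s) , expansions-enumerate (suc s) ,
  trans (length-expansions (suc s)) (cong (suc s *_) (sym (catalan≡descendants (suc s)))) ,
  trans (length-expansions (suc s)) (trans (suc-mul-descendants s) (cong (_C s) (sym (twice-minus-four s))))
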